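{- Let $f:[n]\times[n]\times[N]\to\{0,1\}$ be a function such that every line in the third dimension contains at most a single $1$, and let $S$ be a symmetric cylinder intersection with respect to $f$. Let $G_S$ be the graph with vertex set $V_A\cup V_B$, where $V_A=[n]$ and $V_B=[N]$ are disjoint, and edge set $$E_S=\{\{x,y\},\{x,z\},\{y,z\}:\ (x,y,z)\in S\}$$ (with $x,y$ regarded as vertices of $V_A$ and $z$ as a vertex of $V_B$). Then for $x,y\in V_A$ and $z\in V_B$, the vertices $x,y,z$ form a triangle in $G_S$ if and only if $(x,y,z)\in S$.
   Context: A line in the third dimension of $[n]\times[n]\times[N]$ is a set $\{(x,y,z): z\in[N]\}$ for fixed $x,y$. Number-On-the-Forehead (one-sided) model with 3 players: on input $(x,y,z)$ player 1 sees $(y,z)$, player 2 sees $(x,z)$, player 3 sees $(x,y)$. Following an agreed protocol, players take turns writing bits on a common board; each message depends on what the writer sees and, except for player 3, on the board so far; player 3's message depends only on $(x,y)$. The value of $f$ is determined by the final board. The transcript $\mathcal{T}(x,y,z)$ is the full board content. A cylinder intersection with respect to $f$ is a set $\{(x,y,z):\ \mathcal{T}(x,y,z)=T,\ f(x,y,z)=1\}$ for some protocol for $f$ and some transcript $T$. $S$ is symmetric if $(x,y,z)\in S$ iff $(y,x,z)\in S$. -}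

module Defs where

open import Data.Nat using (ℕ; suc)
open import Data.Fin using (Fin)
open import Data.Bool using (Bool; true; false; if_then_else_)
open import Data.List using (List; []; _∷_)
open import Data.Product using (_×_; _,_; proj₁; proj₂; Σ; ∃)
open import Data.Sum using (_⊎_; inj₁; inj₂)
open import Relation.Binary.PropositionalEquality using (_≡_)

-- Protocol trees for the one-sided 3-player NOF model.
--  * say₁ g t₀ t₁ : player 1 writes the bit g y z (he sees (y,z)); the
--    dependence on the board so far is the position in the tree.
--    The protocol continues with t₀ if the bit is false, t₁ if true.
--  * say₂ g t₀ t₁ : player 2 writes the bit g x z (he sees (x,z)).
--  * say₃ t₀ t₁   : player 3 writes his next bit; player 3's bits are
--    given by a fixed stream depending ONLY on (x,y) (see Protocol.msg₃),
--    so they do not depend on the board.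
--  * leaf b       : the protocol ends with output b (so the output is a
--    function of the final board).
data Tree (n N : ℕ) : Set where
  leaf : Bool → Tree n N
  say₁ : (Fin n → Fin N → Bool) → Tree n N → Tree n N → Tree n N
  say₂ : (Fin n → Fin N → Bool) → Tree n N → Tree n N → Tree n N
  say₃ : Tree n N → Tree n N → Tree n N

record Protocol (n N : ℕ) : Set where
  field
    tree : Tree n N
    -- msg₃ x y k : the k-th bit written by player 3 on input (x,y,_)
    msg₃ : Fin n → Fin n → ℕ → Bool

-- run t k x y z : (board content written from node t on, output),
-- where k is the number of bits player 3 has already written.
run : ∀ {n N} → Tree n N → (Fin n → Fin n → ℕ → Bool) → ℕ →
      Fin n → Fin n → Fin N → List Bool × Bool
run (leaf b) m k x y z = [] , b
run (say₁ g t₀ t₁) m k x y z with g y z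
... | false = let r = run t₀ m k x y z in (false ∷ proj₁ r) , proj₂ r
... | true  = let r = run t₁ m k x y z in (true ∷ proj₁ r) , proj₂ r
run (say₂ g t₀ t₁) m k x y z with g x z
... | false = let r = run t₀ m k x y z in (false ∷ proj₁ r) , proj₂ r
... | true  = let r = run t₁ m k x y z in (true ∷ proj₁ r) , proj₂ r
run (say₃ t₀ t₁) m k x y z with m x y k
... | false = let r = run t₀ m (suc k) x y z in (false ∷ proj₁ r) , proj₂ r
... | true  = let r = run t₁ m (suc k) x y z in (true ∷ proj₁ r) , proj₂ r

transcript : ∀ {n N} → Protocol n N → Fin n → Fin n → Fin N → List Bool
transcript P x y z = proj₁ (run (Protocol.tree P) (Protocol.msg₃ P) 0 x y z)

output : ∀ {n N} → Protocol n N → Fin n → Fin n → Fin N → Bool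
output P x y z = proj₂ (run (Protocol.tree P) (Protocol.msg₃ P) 0 x y z)

Computes : ∀ {n N} → Protocol n N → (Fin n → Fin n → Fin N → Bool) → Set
Computes P f = ∀ x y z → output P x y z ≡ f x y z

Subset3 : ℕ → ℕ → Set₁
Subset3 n N = Fin n → Fin n → Fin N → Set

CylinderIntersection : ∀ {n N} → (Fin n → Fin n → Fin N → Bool) → Subset3 n N → Set
CylinderIntersection {n} {N} f S =
  Σ (Protocol n N) λ P → Computes P f × Σ (List Bool) λ T →
    ∀ x y z → (S x y z → transcript P x y z ≡ T × f x y z ≡ true)
            × (transcript P x y z ≡ T × f x y z ≡ true → S x y z)

Symmetric : ∀ {n N} → Subset3 n N → Set
Symmetric S = ∀ x y z → (S x y z → S y x z) × (S y x z → S x y z)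

AtMostOnePerLine : ∀ {n N} → (Fin n → Fin n → Fin N → Bool) → Set
AtMostOnePerLine f = ∀ x y z z′ → f x y z ≡ true → f x y z′ ≡ true → z ≡ z′

Vertex : ℕ → ℕ → Set
Vertex n N = Fin n ⊎ Fin N

SamePair : ∀ {A : Set} → A → A → A → A → Set
SamePair a b c d = (a ≡ c × b ≡ d) ⊎ (a ≡ d × b ≡ c)

Edge : ∀ {n N} → Subset3 n N → Vertex n N → Vertex n N → Set
Edge S a b = ∃ λ x → ∃ λ y → ∃ λ z → S x y z ×
  (SamePair a b (inj₁ x) (inj₁ y) ⊎ SamePair a b (inj₁ x) (inj₂ z)
     ⊎ SamePair a b (inj₁ y) (inj₂ z))

Triangle : ∀ {n N} → Subset3 n N → Fin n → Fin n → Fin N → Set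
Triangle S x y z = Edge S (inj₁ x) (inj₁ y) × Edge S (inj₁ x) (inj₂ z)
                 × Edge S (inj₁ y) (inj₂ z)

module Submission where

-- The backward direction is immediate: a point (x,y,z) of S
-- contributes all three edges of its own triangle.  For the forward
-- direction, each edge of the triangle is contributed by some point of S
-- (up to the symmetry x ↔ y): {x,y} by (x,y,c), {x,z} by (x,b,z) and
-- {y,z} by (a,y,z).  The heart of the argument is the basic property of
-- number-on-the-forehead protocols: player 1 cannot tell (x,y,z) from
-- (a,y,z), player 2 cannot tell it from (x,b,z), and player 3 cannot tell
-- it from (x,y,c).  So if these three inputs produce one and the same
-- board, then (x,y,z) produces that board too (`cylinder-run`).  Hence a
-- cylinder intersection containing the three points contains (x,y,z)
-- (`cylinder-closed`).

open import Defs
open import Data.Nat using (ℕ; suc)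
open import Data.Fin using (Fin)
open import Data.Bool using (Bool; true; false)
open import Data.List using (List; _∷_)
open import Data.List.Properties using (∷-injectiveʳ)
open import Data.Product using (_×_; _,_; proj₁; proj₂; ∃)
open import Data.Sum using (inj₁; inj₂)
open import Relation.Binary.PropositionalEquality using (_≡_; refl; sym; trans; cong; module ≡-Reasoning)

extend : Bool → List Bool × Bool → List Bool × Bool
extend β r = (β ∷ proj₁ r) , proj₂ r

module _ {n N : ℕ} (m : Fin n → Fin n → ℕ → Bool)
         (a b x y : Fin n) (c z : Fin N) where

  -- At every node the bit of
  -- (x,y,z) is computed from the view it shares with one of the three
  -- inputs, so no node can separate it from (x,y,c).  Nodes where the
  -- three bits disagree are ruled out by the equal boards.
  cylinder-run : (t : Tree n N) (k : ℕ) →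
    proj₁ (run t m k a y z) ≡ proj₁ (run t m k x y c) →
    proj₁ (run t m k x b z) ≡ proj₁ (run t m k x y c) →
    run t m k x y z ≡ run t m k x y c
  cylinder-run (leaf v) k e₁ e₂ = refl
  cylinder-run (say₁ g t₀ t₁) k e₁ e₂ with g y z | g b z | g y c
  ... | false | false | false =
    cong (extend false) (cylinder-run t₀ k (∷-injectiveʳ e₁) (∷-injectiveʳ e₂))
  ... | true  | true  | true  =
    cong (extend true) (cylinder-run t₁ k (∷-injectiveʳ e₁) (∷-injectiveʳ e₂))
  ... | false | _     | true  with () ← e₁
  ... | true  | _     | false with () ← e₁
  ... | _     | false | true  with () ← e₂
  ... | _     | true  | false with () ← e₂
  cylinder-run (say₂ g t₀ t₁) k e₁ e₂ with g a z | g x z | g x c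
  ... | false | false | false =
    cong (extend false) (cylinder-run t₀ k (∷-injectiveʳ e₁) (∷-injectiveʳ e₂))
  ... | true  | true  | true  =
    cong (extend true) (cylinder-run t₁ k (∷-injectiveʳ e₁) (∷-injectiveʳ e₂))
  ... | false | _     | true  with () ← e₁
  ... | true  | _     | false with () ← e₁
  ... | _     | false | true  with () ← e₂
  ... | _     | true  | false with () ← e₂
  cylinder-run (say₃ t₀ t₁) k e₁ e₂ with m a y k | m x b k | m x y k
  ... | false | false | false =
    cong (extend false) (cylinder-run t₀ (suc k) (∷-injectiveʳ e₁) (∷-injectiveʳ e₂))
  ... | true  | true  | true  =
    cong (extend true) (cylinder-run t₁ (suc k) (∷-injectiveʳ e₁) (∷-injectiveʳ e₂))
  ... | false | _     | true  with () ← e₁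
  ... | true  | _     | false with () ← e₁
  ... | _     | false | true  with () ← e₂
  ... | _     | true  | false with () ← e₂

module _ {n N : ℕ} {S : Subset3 n N} where

  cylinder-closed : ∀ {f} → CylinderIntersection f S → ∀ {a b x y c z} →
    S x y c → S x b z → S a y z → S x y z
  cylinder-closed {f} (P , computes , T , ci) {a} {b} {x} {y} {c} {z} sxyc sxbz sayz =
    proj₂ (ci x y z) (transcript-xyz , value-xyz)
    where
    open Protocol P
    board-xyc : transcript P x y c ≡ T
    board-xyc = proj₁ (proj₁ (ci x y c) sxyc)
    board-xbz : transcript P x b z ≡ T
    board-xbz = proj₁ (proj₁ (ci x b z) sxbz)
    board-ayz : transcript P a y z ≡ T
    board-ayz = proj₁ (proj₁ (ci a y z) sayz)
    same-run : run tree msg₃ 0 x y z ≡ run tree msg₃ 0 x y c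
    same-run = cylinder-run msg₃ a b x y c z tree 0
      (trans board-ayz (sym board-xyc)) (trans board-xbz (sym board-xyc))
    transcript-xyz : transcript P x y z ≡ T
    transcript-xyz = trans (cong proj₁ same-run) board-xyc
    value-xyz : f x y z ≡ true
    value-xyz = begin
      f x y z          ≡⟨ sym (computes x y z) ⟩
      output P x y z   ≡⟨ cong proj₂ same-run ⟩
      output P x y c   ≡⟨ computes x y c ⟩
      f x y c          ≡⟨ proj₂ (proj₁ (ci x y c) sxyc) ⟩
      true             ∎
      where open ≡-Reasoning

  point-triangle : ∀ {x y z} → S x y z → Triangle S x y z
  point-triangle {x} {y} {z} s =
      (x , y , z , s , inj₁ (inj₁ (refl , refl)))
    , (x , y , z , s , inj₂ (inj₁ (inj₁ (refl , refl))))
    , (x , y , z , s , inj₂ (inj₂ (inj₁ (refl , refl))))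

  edge-AA : Symmetric S → ∀ {x y} → Edge S (inj₁ x) (inj₁ y) → ∃ λ c → S x y c
  edge-AA sym-S (_ , _ , c , s , inj₁ (inj₁ (refl , refl))) = c , s
  edge-AA sym-S (p , q , c , s , inj₁ (inj₂ (refl , refl))) = c , proj₁ (sym-S p q c) s
  edge-AA sym-S (_ , _ , _ , _ , inj₂ (inj₁ (inj₁ (_ , ()))))
  edge-AA sym-S (_ , _ , _ , _ , inj₂ (inj₁ (inj₂ (() , _))))
  edge-AA sym-S (_ , _ , _ , _ , inj₂ (inj₂ (inj₁ (_ , ()))))
  edge-AA sym-S (_ , _ , _ , _ , inj₂ (inj₂ (inj₂ (() , _))))

  edge-AB : Symmetric S → ∀ {x z} → Edge S (inj₁ x) (inj₂ z) → ∃ λ b → S x b z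
  edge-AB sym-S (_ , _ , _ , _ , inj₁ (inj₁ (_ , ())))
  edge-AB sym-S (_ , _ , _ , _ , inj₁ (inj₂ (_ , ())))
  edge-AB sym-S (_ , q , _ , s , inj₂ (inj₁ (inj₁ (refl , refl)))) = q , s
  edge-AB sym-S (_ , _ , _ , _ , inj₂ (inj₁ (inj₂ (() , _))))
  edge-AB sym-S (p , q , r , s , inj₂ (inj₂ (inj₁ (refl , refl)))) = p , proj₁ (sym-S p q r) s
  edge-AB sym-S (_ , _ , _ , _ , inj₂ (inj₂ (inj₂ (() , _))))

lemma4p5 : (n N : ℕ) (f : Fin n → Fin n → Fin N → Bool) (S : Subset3 n N) →
    AtMostOnePerLine f → CylinderIntersection f S → Symmetric S →
    (x y : Fin n) (z : Fin N) →
    (Triangle S x y z → S x y z) × (S x y z → Triangle S x y z)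
lemma4p5 n N f S _ cyl sym-S x y z = triangle⇒point , point-triangle
  where
  triangle⇒point : Triangle S x y z → S x y z
  triangle⇒point (e-xy , e-xz , e-yz) with edge-AA sym-S e-xy | edge-AB sym-S e-xz | edge-AB sym-S e-yz
  ... | c , sxyc | b , sxbz | a , syaz =
    cylinder-closed cyl sxyc sxbz (proj₁ (sym-S y a z) syaz)
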